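{- For any graph $G=(V,E)$ and any set $X\subseteq V$, $\gamma_P(G;X)=\gamma_P(\ell_2(G,X))$.
   Context: All graphs are finite, simple and undirected. For a graph $G$ and $X\subseteq V(G)$, $\ell_r(G,X)$ denotes the graph obtained from $G$ by attaching $r$ new leaves (new vertices of degree one) to each vertex of $X$. $N(v)$ denotes the set of neighbors of $v$, $N[v]=N(v)\cup\{v\}$, $N[S]=\bigcup_{v\in S}N[v]$. For $S\subseteq V$, the set $PD(S)$ is defined by: initially $PD(S)=N[S]$; while there exists $v\in PD(S)$ with $|N(v)\setminus PD(S)|=1$, replace $PD(S)$ by $PD(S)\cup N(v)$. $S$ is a power dominating set if at the end $PD(S)$ is the whole vertex set. $\gamma_P(H)$ is the minimum size of a power dominating set of $H$, and $\gamma_P(G;X)$ the minimum size of a power dominating set of $G$ containing $X$. -}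

module Defs where

open import Data.Bool using (Bool; true; false)
open import Data.Nat using (ℕ; _+_; _*_; _≤_)
open import Data.Fin using (Fin; splitAt; remQuot; _≟_)
open import Data.Fin.Subset using (Subset; _∈_; _∉_; _⊆_; _∪_; ⁅_⁆; ⋃; ∣_∣; ⊤)
open import Data.Fin.Subset.Properties using (_∈?_)
open import Data.List using (List; map; filter; length; lookup; allFin)
open import Data.Vec using (tabulate)
open import Data.Sum using (inj₁; inj₂)
open import Data.Product using (Σ; _×_; _,_)
open import Relation.Nullary using (¬_)
open import Relation.Nullary.Decidable using (⌊_⌋)
open import Relation.Binary.PropositionalEquality using (_≡_)
open import Relation.Binary.Construct.Closure.ReflexiveTransitive using (Star)

Graph : ℕ → Set
Graph n = Fin n → Fin n → Bool

IsSimple : ∀ {n} → Graph n → Set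
IsSimple {n} G = (∀ (u v : Fin n) → G u v ≡ G v u) × (∀ (v : Fin n) → G v v ≡ false)

N : ∀ {n} → Graph n → Fin n → Subset n
N G v = tabulate (G v)

N[_] : ∀ {n} → Graph n → Fin n → Subset n
N[ G ] v = ⁅ v ⁆ ∪ N G v

elements : ∀ {n} → Subset n → List (Fin n)
elements {n} S = filter (λ i → i ∈? S) (allFin n)

NS : ∀ {n} → Graph n → Subset n → Subset n
NS G S = ⋃ (map (N[ G ]) (elements S))

data Step {n} (G : Graph n) : Subset n → Subset n → Set where
  step : ∀ {P} (v w : Fin n) → v ∈ P → w ∈ N G v → w ∉ P →
         (∀ w' → w' ∈ N G v → w' ∉ P → w' ≡ w) →
         Step G P (P ∪ N G v)

PowerDominating : ∀ {n} → Graph n → Subset n → Set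
PowerDominating G S = Star (Step G) (NS G S) ⊤

γP≡ : ∀ {n} → Graph n → ℕ → Set
γP≡ {n} G k =
  Σ (Subset n) (λ S → PowerDominating G S × ∣ S ∣ ≡ k)
  × (∀ (S : Subset n) → PowerDominating G S → k ≤ ∣ S ∣)

γP[_]≡ : ∀ {n} → Graph n → Subset n → ℕ → Set
γP[_]≡ {n} G X k =
  Σ (Subset n) (λ S → X ⊆ S × PowerDominating G S × ∣ S ∣ ≡ k)
  × (∀ (S : Subset n) → X ⊆ S → PowerDominating G S → k ≤ ∣ S ∣)

-- ℓ_r(G,X): vertices Fin (n + |X| * r); the first n are the vertices of G,
-- a new vertex l (index in Fin (|X| * r)) with remQuot r l = (j , i) is the
-- i-th leaf attached to the j-th element of X.
-- the vertex of G to which leaf l of ℓ_r(G,X) is attached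
leafOwner : ∀ {n} (r : ℕ) (X : Subset n) → Fin (length (elements X) * r) → Fin n
leafOwner r X l with remQuot r l
... | j , _ = lookup (elements X) j

ℓ : ∀ {n} (r : ℕ) (G : Graph n) (X : Subset n) →
    Graph (n + length (elements X) * r)
ℓ {n} r G X u w with splitAt n u | splitAt n w
... | inj₁ a | inj₁ b = G a b
... | inj₁ a | inj₂ l = ⌊ leafOwner r X l ≟ a ⌋
... | inj₂ l | inj₁ a = ⌊ leafOwner r X l ≟ a ⌋
... | inj₂ _ | inj₂ _ = false

-- Every vertex x ∈ X that a power dominating set T of ℓ₂(G,X) misses must have
-- one of its two leaves in T: otherwise both leaves start unobserved, and being
-- twins they can never be forced, since a forcing vertex adjacent to one of them
-- sees two unobserved neighbours. Replacing the leaves of T by their owners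
-- therefore gives a set S ⊇ X of G with |S| ≤ |T|. Conversely a set S ⊇ X of G
-- observes every leaf at once. Once all leaves are observed, propagation in
-- ℓ₂(G,X) is exactly propagation in G, so both kinds of sets power dominate.
module Submission where

open import Defs
open import Data.Nat using (ℕ)
open import Data.Fin.Subset using (Subset)
open import Function.Bundles using (_⇔_)

open import Data.Bool using (Bool; true; false)
open import Data.Nat using (zero; suc; _+_; _*_; _≤_; z≤n; s≤s)
open import Data.Nat.Properties
  using (≤-reflexive; ≤-trans; ≤-antisym; n≤1+n; +-suc; +-monoʳ-≤; +-identityʳ; module ≤-Reasoning)
open import Data.Fin as Fin using (Fin; _↑ˡ_; _↑ʳ_; splitAt; remQuot; combine; _≟_)
open import Data.Fin.Properties
  using (splitAt-↑ˡ; splitAt-↑ʳ; splitAt⁻¹-↑ˡ; splitAt⁻¹-↑ʳ; ↑ˡ-injective; ↑ʳ-injective;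
         remQuot-combine; combine-injectiveʳ; any?)
open import Data.Fin.Subset using (_∈_; _∉_; _⊆_; _∪_; ⁅_⁆; ⋃; ∣_∣; ⊤; ⊥)
open import Data.Fin.Subset.Properties
  using (_∈?_; ⊆-antisym; ⊆⊤; ∈⊤; ∉⊥; x∈p∪q⁻; x∈p∪q⁺; x∈⁅x⁆; x∈⁅y⁆⇒x≡y;
         p⊆q⇒∣p∣≤∣q∣; ∣⁅x⁆∣≡1; ∣⊥∣≡0)
open import Data.Vec as Vec using ([]; _∷_; _++_; here; there; tabulate)
open import Data.Vec.Properties
  using ([]=⇒lookup; lookup⇒[]=; lookup∘tabulate; lookup-++ˡ; lookup-++ʳ; ++-injectiveˡ)
open import Data.List using (List; length; allFin) renaming ([] to []ᴸ; _∷_ to _∷ᴸ_; lookup to lookupᴸ)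
open import Data.List.Relation.Unary.Any using (here; there; index)
open import Data.List.Relation.Unary.Any.Properties using (lookup-index)
open import Data.List.Membership.Propositional using () renaming (_∈_ to _∈ᴸ_)
open import Data.List.Membership.Propositional.Properties
  using (∈-filter⁺; ∈-filter⁻; ∈-allFin; ∈-lookup; ∈-map⁺; ∈-map⁻)
open import Data.Sum using (_⊎_; inj₁; inj₂)
open import Data.Product using (Σ; ∃; _×_; _,_; proj₁; proj₂)
open import Data.Empty using (⊥-elim)
open import Function using (_∘_)
open import Function.Bundles using (mk⇔)
open import Relation.Nullary using (¬_; Dec; yes; no)
open import Relation.Nullary.Decidable using (⌊_⌋; _×-dec_)
open import Relation.Binary.PropositionalEquality
  using (_≡_; _≢_; refl; sym; trans; cong; subst; ≢-sym)
open import Relation.Binary.Construct.Closure.ReflexiveTransitive using (Star; ε; _◅_)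

isYes⇒witness : ∀ {a} {A : Set a} (a? : Dec A) → ⌊ a? ⌋ ≡ true → A
isYes⇒witness (yes a) _ = a
isYes⇒witness (no _) ()

witness⇒isYes : ∀ {a} {A : Set a} (a? : Dec A) → A → ⌊ a? ⌋ ≡ true
witness⇒isYes (yes _) _ = refl
witness⇒isYes (no ¬a) a = ⊥-elim (¬a a)

∈-tabulate⁺ : ∀ {m} {f : Fin m → Bool} {x} → f x ≡ true → x ∈ tabulate f
∈-tabulate⁺ {f = f} {x} fx = lookup⇒[]= x _ (trans (lookup∘tabulate f x) fx)

∈-tabulate⁻ : ∀ {m} {f : Fin m → Bool} {x} → x ∈ tabulate f → f x ≡ true
∈-tabulate⁻ {f = f} {x} x∈ = trans (sym (lookup∘tabulate f x)) ([]=⇒lookup x∈)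

module _ {m k} {p : Subset m} {q : Subset k} where

  ∈-++⁺ˡ : ∀ {x} → x ∈ p → x ↑ˡ k ∈ p ++ q
  ∈-++⁺ˡ {x} x∈p = lookup⇒[]= _ _ (trans (lookup-++ˡ p q x) ([]=⇒lookup x∈p))

  ∈-++⁻ˡ : ∀ {x} → x ↑ˡ k ∈ p ++ q → x ∈ p
  ∈-++⁻ˡ {x} x∈ = lookup⇒[]= _ _ (trans (sym (lookup-++ˡ p q x)) ([]=⇒lookup x∈))

  ∈-++⁺ʳ : ∀ {x} → x ∈ q → m ↑ʳ x ∈ p ++ q
  ∈-++⁺ʳ {x} x∈q = lookup⇒[]= _ _ (trans (lookup-++ʳ p q x) ([]=⇒lookup x∈q))

  ∈-++⁻ʳ : ∀ {x} → m ↑ʳ x ∈ p ++ q → x ∈ q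
  ∈-++⁻ʳ {x} x∈ = lookup⇒[]= _ _ (trans (sym (lookup-++ʳ p q x)) ([]=⇒lookup x∈))

↑ʳ∈p++⊤ : ∀ {m k} (p : Subset m) {x : Fin k} → m ↑ʳ x ∈ p ++ ⊤
↑ʳ∈p++⊤ p = ∈-++⁺ʳ {p = p} ∈⊤

⊤++⊤≡⊤ : ∀ m {k} → ⊤ {m} ++ ⊤ {k} ≡ ⊤
⊤++⊤≡⊤ zero    = refl
⊤++⊤≡⊤ (suc m) = cong (true ∷_) (⊤++⊤≡⊤ m)

∣p++q∣≡∣p∣+∣q∣ : ∀ {m k} (p : Subset m) (q : Subset k) → ∣ p ++ q ∣ ≡ ∣ p ∣ + ∣ q ∣
∣p++q∣≡∣p∣+∣q∣ []          q = refl
∣p++q∣≡∣p∣+∣q∣ (true ∷ p)  q = cong suc (∣p++q∣≡∣p∣+∣q∣ p q)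
∣p++q∣≡∣p∣+∣q∣ (false ∷ p) q = ∣p++q∣≡∣p∣+∣q∣ p q

∣p++⊥∣≡∣p∣ : ∀ {m k} (p : Subset m) → ∣ p ++ ⊥ {k} ∣ ≡ ∣ p ∣
∣p++⊥∣≡∣p∣ {k = k} p =
  trans (∣p++q∣≡∣p∣+∣q∣ p ⊥) (trans (cong (∣ p ∣ +_) (∣⊥∣≡0 k)) (+-identityʳ _))

∣p∪q∣≤∣p∣+∣q∣ : ∀ {m} (p q : Subset m) → ∣ p ∪ q ∣ ≤ ∣ p ∣ + ∣ q ∣
∣p∪q∣≤∣p∣+∣q∣ []          []          = z≤n
∣p∪q∣≤∣p∣+∣q∣ (true ∷ p)  (true ∷ q)  =
  s≤s (≤-trans (∣p∪q∣≤∣p∣+∣q∣ p q) (+-monoʳ-≤ ∣ p ∣ (n≤1+n ∣ q ∣)))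
∣p∪q∣≤∣p∣+∣q∣ (true ∷ p)  (false ∷ q) = s≤s (∣p∪q∣≤∣p∣+∣q∣ p q)
∣p∪q∣≤∣p∣+∣q∣ (false ∷ p) (true ∷ q)  rewrite +-suc ∣ p ∣ ∣ q ∣ = s≤s (∣p∪q∣≤∣p∣+∣q∣ p q)
∣p∪q∣≤∣p∣+∣q∣ (false ∷ p) (false ∷ q) = ∣p∪q∣≤∣p∣+∣q∣ p q

image : ∀ {k m} → (Fin k → Fin m) → Subset k → Subset m
image f []          = ⊥
image f (true ∷ p)  = ⁅ f Fin.zero ⁆ ∪ image (f ∘ Fin.suc) p
image f (false ∷ p) = image (f ∘ Fin.suc) p

∈-image⁺ : ∀ {k m} (f : Fin k → Fin m) {p x} → x ∈ p → f x ∈ image f p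
∈-image⁺ f {true ∷ p}  here        = x∈p∪q⁺ (inj₁ (x∈⁅x⁆ (f Fin.zero)))
∈-image⁺ f {true ∷ p}  (there x∈p) = x∈p∪q⁺ (inj₂ (∈-image⁺ (f ∘ Fin.suc) x∈p))
∈-image⁺ f {false ∷ p} (there x∈p) = ∈-image⁺ (f ∘ Fin.suc) x∈p

∣image∣≤∣p∣ : ∀ {k m} (f : Fin k → Fin m) p → ∣ image f p ∣ ≤ ∣ p ∣
∣image∣≤∣p∣ {m = m} f []    = ≤-reflexive (∣⊥∣≡0 m)
∣image∣≤∣p∣ f (true ∷ p)    = begin
  ∣ ⁅ f Fin.zero ⁆ ∪ image (f ∘ Fin.suc) p ∣       ≤⟨ ∣p∪q∣≤∣p∣+∣q∣ ⁅ f Fin.zero ⁆ (image (f ∘ Fin.suc) p) ⟩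
  ∣ ⁅ f Fin.zero ⁆ ∣ + ∣ image (f ∘ Fin.suc) p ∣   ≡⟨ cong (_+ ∣ image (f ∘ Fin.suc) p ∣) (∣⁅x⁆∣≡1 (f Fin.zero)) ⟩
  suc ∣ image (f ∘ Fin.suc) p ∣                    ≤⟨ s≤s (∣image∣≤∣p∣ (f ∘ Fin.suc) p) ⟩
  suc ∣ p ∣                                        ∎
  where open ≤-Reasoning
∣image∣≤∣p∣ f (false ∷ p)   = ∣image∣≤∣p∣ (f ∘ Fin.suc) p

x∈⋃⁻ : ∀ {m} (ps : List (Subset m)) {x} → x ∈ ⋃ ps → ∃ λ p → p ∈ᴸ ps × x ∈ p
x∈⋃⁻ []ᴸ        x∈ = ⊥-elim (∉⊥ x∈)
x∈⋃⁻ (p ∷ᴸ ps) x∈ with x∈p∪q⁻ p (⋃ ps) x∈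
... | inj₁ x∈p = p , here refl , x∈p
... | inj₂ x∈⋃ with x∈⋃⁻ ps x∈⋃
...   | q , q∈ , x∈q = q , there q∈ , x∈q

x∈⋃⁺ : ∀ {m} {ps : List (Subset m)} {p x} → p ∈ᴸ ps → x ∈ p → x ∈ ⋃ ps
x∈⋃⁺ (here refl) x∈p = x∈p∪q⁺ (inj₁ x∈p)
x∈⋃⁺ (there p∈)  x∈p = x∈p∪q⁺ (inj₂ (x∈⋃⁺ p∈ x∈p))

∈-elements⁺ : ∀ {m} {p : Subset m} {x} → x ∈ p → x ∈ᴸ elements p
∈-elements⁺ {p = p} {x} x∈p = ∈-filter⁺ (_∈? p) (∈-allFin x) x∈p

∈-elements⁻ : ∀ {m} {p : Subset m} {x} → x ∈ᴸ elements p → x ∈ p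
∈-elements⁻ {m} {p} x∈ = proj₂ (∈-filter⁻ (_∈? p) {xs = allFin m} x∈)

module _ {m} (G : Graph m) where

  ∈N[]⁻ : ∀ {v u} → u ∈ N[ G ] v → u ≡ v ⊎ u ∈ N G v
  ∈N[]⁻ {v} u∈ with x∈p∪q⁻ ⁅ v ⁆ (N G v) u∈
  ... | inj₁ u∈⁅v⁆ = inj₁ (x∈⁅y⁆⇒x≡y v u∈⁅v⁆)
  ... | inj₂ u∈N   = inj₂ u∈N

  v∈N[v] : ∀ v → v ∈ N[ G ] v
  v∈N[v] v = x∈p∪q⁺ (inj₁ (x∈⁅x⁆ v))

  N⊆N[] : ∀ {v} → N G v ⊆ N[ G ] v
  N⊆N[] u∈N = x∈p∪q⁺ (inj₂ u∈N)

  ∈NS⁻ : ∀ {S u} → u ∈ NS G S → ∃ λ v → v ∈ S × u ∈ N[ G ] v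
  ∈NS⁻ {S} u∈ with x∈⋃⁻ _ u∈
  ... | _ , p∈ , u∈p with ∈-map⁻ N[ G ] p∈
  ...   | v , v∈ , refl = v , ∈-elements⁻ v∈ , u∈p

  ∈NS⁺ : ∀ {S u v} → v ∈ S → u ∈ N[ G ] v → u ∈ NS G S
  ∈NS⁺ v∈S u∈ = x∈⋃⁺ (∈-map⁺ N[ G ] (∈-elements⁺ v∈S)) u∈

  ForcesAll : Subset m → Set
  ForcesAll P = Star (Step G) P ⊤

  forcesAll-mono : ∀ {P Q} → P ⊆ Q → ForcesAll P → ForcesAll Q
  forcesAll-mono P⊆Q ε = subst ForcesAll (⊆-antisym P⊆Q ⊆⊤) ε
  forcesAll-mono {P} {Q} P⊆Q (step v w v∈P w∈N w∉P unique ◅ rest) with w ∈? Q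
  ... | yes w∈Q = forcesAll-mono absorbed rest
    where
    -- every neighbour of v other than w already lies in P
    absorbed : P ∪ N G v ⊆ Q
    absorbed {x} x∈ with x∈p∪q⁻ P (N G v) x∈ | x ∈? Q
    ... | inj₁ x∈P | _       = P⊆Q x∈P
    ... | inj₂ _   | yes x∈Q = x∈Q
    ... | inj₂ x∈N | no x∉Q  = subst (_∈ Q) (sym (unique x x∈N (x∉Q ∘ P⊆Q))) w∈Q
  ... | no w∉Q =
    step v w (P⊆Q v∈P) w∈N w∉Q (λ x x∈N x∉Q → unique x x∈N (x∉Q ∘ P⊆Q))
      ◅ forcesAll-mono grown rest
    where
    grown : P ∪ N G v ⊆ Q ∪ N G v
    grown {x} x∈ with x∈p∪q⁻ P (N G v) x∈
    ... | inj₁ x∈P = x∈p∪q⁺ (inj₁ (P⊆Q x∈P))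
    ... | inj₂ x∈N = x∈p∪q⁺ (inj₂ x∈N)

  twins-unforceable : ∀ {u u'} → u ≢ u' →
    (∀ {v} → u ∈ N G v → u' ∈ N G v) → (∀ {v} → u' ∈ N G v → u ∈ N G v) →
    ∀ {P} → u ∉ P → u' ∉ P → ¬ ForcesAll P
  twins-unforceable _ _ _ u∉P _ ε = u∉P ∈⊤
  twins-unforceable u≢u' u→u' u'→u {P} u∉P u'∉P (step v w _ _ _ unique ◅ rest) =
    twins-unforceable u≢u' u→u' u'→u
      (stays-out u≢u' u→u' u∉P u'∉P) (stays-out (≢-sym u≢u') u'→u u'∉P u∉P) rest
    where
    stays-out : ∀ {x y} → x ≢ y → (x ∈ N G v → y ∈ N G v) → x ∉ P → y ∉ P → x ∉ P ∪ N G v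
    stays-out x≢y x→y x∉P y∉P x∈ with x∈p∪q⁻ P (N G v) x∈
    ... | inj₁ x∈P = x∉P x∈P
    ... | inj₂ x∈N = x≢y (trans (unique _ x∈N x∉P) (sym (unique _ (x→y x∈N) y∉P)))

module LeafGraph {n} (G : Graph n) (X : Subset n) where

  M : ℕ
  M = length (elements X) * 2

  H : Graph (n + M)
  H = ℓ 2 G X

  owner : Fin M → Fin n
  owner = leafOwner 2 X

  data View : Fin (n + M) → Set where
    old  : (a : Fin n) → View (a ↑ˡ M)
    leaf : (l : Fin M) → View (n ↑ʳ l)

  view : ∀ u → View u
  view u with splitAt n u in eq
  ... | inj₁ a = subst View (splitAt⁻¹-↑ˡ eq) (old a)
  ... | inj₂ l = subst View (splitAt⁻¹-↑ʳ eq) (leaf l)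

  ↑ˡ≢↑ʳ : ∀ a l → a ↑ˡ M ≢ n ↑ʳ l
  ↑ˡ≢↑ʳ a l eq with trans (sym (splitAt-↑ˡ n a M)) (trans (cong (splitAt n) eq) (splitAt-↑ʳ n M l))
  ... | ()

  owner-combine : ∀ j i → owner (combine j i) ≡ lookupᴸ (elements X) j
  owner-combine j i = cong (lookupᴸ (elements X) ∘ proj₁) (remQuot-combine {k = 2} j i)

  owner∈X : ∀ l → owner l ∈ X
  owner∈X l = ∈-elements⁻ (∈-lookup (proj₁ (remQuot {length (elements X)} 2 l)))

  H-↑ˡ-↑ˡ : ∀ a b → H (a ↑ˡ M) (b ↑ˡ M) ≡ G a b
  H-↑ˡ-↑ˡ a b rewrite splitAt-↑ˡ n a M | splitAt-↑ˡ n b M = refl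

  H-↑ˡ-↑ʳ : ∀ a l → H (a ↑ˡ M) (n ↑ʳ l) ≡ ⌊ owner l ≟ a ⌋
  H-↑ˡ-↑ʳ a l rewrite splitAt-↑ˡ n a M | splitAt-↑ʳ n M l = refl

  H-↑ʳ-↑ˡ : ∀ l a → H (n ↑ʳ l) (a ↑ˡ M) ≡ ⌊ owner l ≟ a ⌋
  H-↑ʳ-↑ˡ l a rewrite splitAt-↑ˡ n a M | splitAt-↑ʳ n M l = refl

  H-↑ʳ-↑ʳ : ∀ l l' → H (n ↑ʳ l) (n ↑ʳ l') ≡ false
  H-↑ʳ-↑ʳ l l' rewrite splitAt-↑ʳ n M l | splitAt-↑ʳ n M l' = refl

  ↑ˡ∈N↑ˡ⁺ : ∀ {a c} → c ∈ N G a → c ↑ˡ M ∈ N H (a ↑ˡ M)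
  ↑ˡ∈N↑ˡ⁺ {a} {c} c∈ = ∈-tabulate⁺ (trans (H-↑ˡ-↑ˡ a c) (∈-tabulate⁻ c∈))

  ↑ˡ∈N↑ˡ⁻ : ∀ {a c} → c ↑ˡ M ∈ N H (a ↑ˡ M) → c ∈ N G a
  ↑ˡ∈N↑ˡ⁻ {a} {c} c∈ = ∈-tabulate⁺ (trans (sym (H-↑ˡ-↑ˡ a c)) (∈-tabulate⁻ c∈))

  ↑ʳ∈N↑ˡ⁺ : ∀ {a l} → owner l ≡ a → n ↑ʳ l ∈ N H (a ↑ˡ M)
  ↑ʳ∈N↑ˡ⁺ {a} {l} owned = ∈-tabulate⁺ (trans (H-↑ˡ-↑ʳ a l) (witness⇒isYes (owner l ≟ a) owned))

  ↑ʳ∈N↑ˡ⁻ : ∀ {a l} → n ↑ʳ l ∈ N H (a ↑ˡ M) → owner l ≡ a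
  ↑ʳ∈N↑ˡ⁻ {a} {l} l∈ = isYes⇒witness (owner l ≟ a) (trans (sym (H-↑ˡ-↑ʳ a l)) (∈-tabulate⁻ l∈))

  ↑ˡ∈N↑ʳ⁻ : ∀ {l a} → a ↑ˡ M ∈ N H (n ↑ʳ l) → owner l ≡ a
  ↑ˡ∈N↑ʳ⁻ {l} {a} a∈ = isYes⇒witness (owner l ≟ a) (trans (sym (H-↑ʳ-↑ˡ l a)) (∈-tabulate⁻ a∈))

  ↑ʳ∉N↑ʳ : ∀ {l l'} → n ↑ʳ l' ∉ N H (n ↑ʳ l)
  ↑ʳ∉N↑ʳ {l} {l'} l'∈ with trans (sym (H-↑ʳ-↑ʳ l l')) (∈-tabulate⁻ l'∈)
  ... | ()

  ↑ʳ-twins : ∀ {l l' v} → owner l ≡ owner l' → n ↑ʳ l ∈ N H v → n ↑ʳ l' ∈ N H v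
  ↑ʳ-twins {v = v} same l∈ with view v
  ... | old a  = ↑ʳ∈N↑ˡ⁺ (trans (sym same) (↑ʳ∈N↑ˡ⁻ l∈))
  ... | leaf _ = ⊥-elim (↑ʳ∉N↑ʳ l∈)

  ↑ʳ∉NS : ∀ {p r l} → owner l ∉ p → l ∉ r → n ↑ʳ l ∉ NS H (p ++ r)
  ↑ʳ∉NS {p} {r} {l} owner∉p l∉r l∈ with ∈NS⁻ H l∈
  ... | t , t∈ , l∈N[t] with view t | ∈N[]⁻ H l∈N[t]
  ...   | old a  | inj₁ l≡a = ↑ˡ≢↑ʳ a l (sym l≡a)
  ...   | old a  | inj₂ l∈N = owner∉p (subst (_∈ p) (sym (↑ʳ∈N↑ˡ⁻ l∈N)) (∈-++⁻ˡ t∈))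
  ...   | leaf k | inj₁ l≡k = l∉r (subst (_∈ r) (sym (↑ʳ-injective n l k l≡k)) (∈-++⁻ʳ t∈))
  ...   | leaf k | inj₂ l∈N = ↑ʳ∉N↑ʳ l∈N

  missed⇒leaf-chosen : ∀ {p r x} → PowerDominating H (p ++ r) → x ∈ X → x ∉ p →
                      ∃ λ l → l ∈ r × owner l ≡ x
  missed⇒leaf-chosen {p} {r} {x} pd x∈X x∉p with any? (λ l → (l ∈? r) ×-dec (owner l ≟ x))
  ... | yes found = found
  ... | no none   = ⊥-elim (
    twins-unforceable H leaf₀≢leaf₁ (↑ʳ-twins same) (↑ʳ-twins (sym same))
      (unobserved Fin.zero) (unobserved (Fin.suc Fin.zero)) pd)
    where
    j : Fin (length (elements X))
    j = index (∈-elements⁺ x∈X)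

    owner≡x : ∀ i → owner (combine j i) ≡ x
    owner≡x i = trans (owner-combine j i) (sym (lookup-index (∈-elements⁺ x∈X)))

    same : owner (combine j Fin.zero) ≡ owner (combine j (Fin.suc Fin.zero))
    same = trans (owner≡x Fin.zero) (sym (owner≡x (Fin.suc Fin.zero)))

    unobserved : ∀ i → n ↑ʳ combine j i ∉ NS H (p ++ r)
    unobserved i = ↑ʳ∉NS (subst (_∉ p) (sym (owner≡x i)) x∉p) (λ l∈r → none (_ , l∈r , owner≡x i))

    leaf₀≢leaf₁ : n ↑ʳ combine j Fin.zero ≢ n ↑ʳ combine j (Fin.suc Fin.zero)
    leaf₀≢leaf₁ eq with combine-injectiveʳ j Fin.zero j (Fin.suc Fin.zero) (↑ʳ-injective n _ _ eq)
    ... | ()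

  ++⊤∪N↑ˡ : ∀ P a → (P ++ ⊤) ∪ N H (a ↑ˡ M) ≡ (P ∪ N G a) ++ ⊤
  ++⊤∪N↑ˡ P a = ⊆-antisym ⊆-to ⊆-from
    where
    ⊆-to : (P ++ ⊤) ∪ N H (a ↑ˡ M) ⊆ (P ∪ N G a) ++ ⊤
    ⊆-to {u} u∈ with view u | x∈p∪q⁻ (P ++ ⊤) (N H (a ↑ˡ M)) u∈
    ... | old c  | inj₁ c∈P = ∈-++⁺ˡ {q = ⊤} (x∈p∪q⁺ (inj₁ (∈-++⁻ˡ c∈P)))
    ... | old c  | inj₂ c∈N = ∈-++⁺ˡ {q = ⊤} (x∈p∪q⁺ (inj₂ (↑ˡ∈N↑ˡ⁻ c∈N)))
    ... | leaf l | _        = ↑ʳ∈p++⊤ (P ∪ N G a)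

    ⊆-from : (P ∪ N G a) ++ ⊤ ⊆ (P ++ ⊤) ∪ N H (a ↑ˡ M)
    ⊆-from {u} u∈ with view u
    ... | leaf l = x∈p∪q⁺ (inj₁ (↑ʳ∈p++⊤ P))
    ... | old c with x∈p∪q⁻ P (N G a) (∈-++⁻ˡ u∈)
    ...   | inj₁ c∈P = x∈p∪q⁺ (inj₁ (∈-++⁺ˡ c∈P))
    ...   | inj₂ c∈N = x∈p∪q⁺ (inj₂ (↑ˡ∈N↑ˡ⁺ c∈N))

  lift : ∀ {P} → ForcesAll G P → ForcesAll H (P ++ ⊤)
  lift ε = subst (ForcesAll H) (sym (⊤++⊤≡⊤ n)) ε
  lift {P} (step a b a∈P b∈N b∉P unique ◅ rest) =
    step (a ↑ˡ M) (b ↑ˡ M) (∈-++⁺ˡ a∈P) (↑ˡ∈N↑ˡ⁺ b∈N) (b∉P ∘ ∈-++⁻ˡ) uniqueᴴ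
      ◅ subst (ForcesAll H) (sym (++⊤∪N↑ˡ P a)) (lift rest)
    where
    uniqueᴴ : ∀ u → u ∈ N H (a ↑ˡ M) → u ∉ P ++ ⊤ → u ≡ b ↑ˡ M
    uniqueᴴ u u∈N u∉ with view u
    ... | old c  = cong (_↑ˡ M) (unique c (↑ˡ∈N↑ˡ⁻ u∈N) (u∉ ∘ ∈-++⁺ˡ))
    ... | leaf l = ⊥-elim (u∉ (↑ʳ∈p++⊤ P))

  project : ∀ {P} → X ⊆ P → ForcesAll H (P ++ ⊤) → ForcesAll G P
  project X⊆P forces = go forces X⊆P refl
    where
    go : ∀ {Q P} → ForcesAll H Q → X ⊆ P → Q ≡ P ++ ⊤ → ForcesAll G P
    go {P = P} ε _ ⊤≡P++⊤ =
      subst (ForcesAll G) (++-injectiveˡ ⊤ P (trans (⊤++⊤≡⊤ n) ⊤≡P++⊤)) ε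
    go {P = P} (step v w v∈ w∈N w∉ unique ◅ rest) X⊆P refl with view v | view w
    ... | old a  | old b  =
      step a b (∈-++⁻ˡ v∈) (↑ˡ∈N↑ˡ⁻ w∈N) (w∉ ∘ ∈-++⁺ˡ)
           (λ c c∈N c∉P → ↑ˡ-injective M c b (unique (c ↑ˡ M) (↑ˡ∈N↑ˡ⁺ c∈N) (c∉P ∘ ∈-++⁻ˡ)))
        ◅ go rest (λ x∈X → x∈p∪q⁺ (inj₁ (X⊆P x∈X))) (++⊤∪N↑ˡ P a)
    ... | old a  | leaf l = ⊥-elim (w∉ (↑ʳ∈p++⊤ P))
    ... | leaf l | old b  = ⊥-elim (w∉ (∈-++⁺ˡ (X⊆P (subst (_∈ X) (↑ˡ∈N↑ʳ⁻ w∈N) (owner∈X l)))))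
    ... | leaf l | leaf _ = ⊥-elim (↑ʳ∉N↑ʳ w∈N)

  NS-lift : ∀ {S} → X ⊆ S → NS G S ++ ⊤ ⊆ NS H (S ++ ⊥)
  NS-lift X⊆S {u} u∈ with view u
  ... | leaf l = ∈NS⁺ H (∈-++⁺ˡ (X⊆S (owner∈X l))) (N⊆N[] H (↑ʳ∈N↑ˡ⁺ refl))
  ... | old c with ∈NS⁻ G (∈-++⁻ˡ u∈)
  ...   | v , v∈S , c∈N[v] with ∈N[]⁻ G c∈N[v]
  ...     | inj₁ refl = ∈NS⁺ H (∈-++⁺ˡ v∈S) (v∈N[v] H (v ↑ˡ M))
  ...     | inj₂ c∈N  = ∈NS⁺ H (∈-++⁺ˡ v∈S) (N⊆N[] H (↑ˡ∈N↑ˡ⁺ c∈N))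

  NS-project : ∀ {p r} → NS H (p ++ r) ⊆ NS G (p ∪ X) ++ ⊤
  NS-project {p} {r} {u} u∈ with ∈NS⁻ H u∈
  ... | t , t∈ , u∈N[t] with view u | view t | ∈N[]⁻ H u∈N[t]
  ...   | leaf _ | _      | _        = ↑ʳ∈p++⊤ (NS G (p ∪ X))
  ...   | old c  | old a  | inj₁ c≡a =
    ∈-++⁺ˡ (∈NS⁺ G (x∈p∪q⁺ (inj₁ (∈-++⁻ˡ t∈))) (subst (_∈ N[ G ] a) (sym (↑ˡ-injective M c a c≡a)) (v∈N[v] G a)))
  ...   | old c  | old a  | inj₂ c∈N = ∈-++⁺ˡ (∈NS⁺ G (x∈p∪q⁺ (inj₁ (∈-++⁻ˡ t∈))) (N⊆N[] G (↑ˡ∈N↑ˡ⁻ c∈N)))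
  ...   | old c  | leaf l | inj₁ c≡l = ⊥-elim (↑ˡ≢↑ʳ c l c≡l)
  ...   | old c  | leaf l | inj₂ c∈N =
    ∈-++⁺ˡ (∈NS⁺ G (x∈p∪q⁺ (inj₂ (subst (_∈ X) (↑ˡ∈N↑ʳ⁻ c∈N) (owner∈X l)))) (v∈N[v] G c))

  pd-lift : ∀ {S} → X ⊆ S → PowerDominating G S → PowerDominating H (S ++ ⊥)
  pd-lift X⊆S = forcesAll-mono H (NS-lift X⊆S) ∘ lift

  pd-project : ∀ T → PowerDominating H T →
               Σ (Subset n) λ S → X ⊆ S × PowerDominating G S × ∣ S ∣ ≤ ∣ T ∣
  pd-project T pd with Vec.splitAt n T
  ... | p , r , refl = p ∪ X , x∈p∪q⁺ ∘ inj₂ , project X⊆NS (forcesAll-mono H NS-project pd) , size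
    where
    X⊆NS : X ⊆ NS G (p ∪ X)
    X⊆NS {x} x∈X = ∈NS⁺ G (x∈p∪q⁺ (inj₂ x∈X)) (v∈N[v] G x)

    X-replaced : p ∪ X ⊆ p ∪ image owner r
    X-replaced {x} x∈ with x∈p∪q⁻ p X x∈ | x ∈? p
    ... | inj₁ x∈p | _       = x∈p∪q⁺ (inj₁ x∈p)
    ... | inj₂ _   | yes x∈p = x∈p∪q⁺ (inj₁ x∈p)
    ... | inj₂ x∈X | no x∉p  with missed⇒leaf-chosen pd x∈X x∉p
    ...   | l , l∈r , refl = x∈p∪q⁺ (inj₂ (∈-image⁺ owner l∈r))

    size : ∣ p ∪ X ∣ ≤ ∣ p ++ r ∣
    size = begin
      ∣ p ∪ X ∣                  ≤⟨ p⊆q⇒∣p∣≤∣q∣ X-replaced ⟩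
      ∣ p ∪ image owner r ∣      ≤⟨ ∣p∪q∣≤∣p∣+∣q∣ p (image owner r) ⟩
      ∣ p ∣ + ∣ image owner r ∣  ≤⟨ +-monoʳ-≤ ∣ p ∣ (∣image∣≤∣p∣ owner r) ⟩
      ∣ p ∣ + ∣ r ∣              ≡⟨ sym (∣p++q∣≡∣p∣+∣q∣ p r) ⟩
      ∣ p ++ r ∣                 ∎
      where open ≤-Reasoning

proposition3p4 : ∀ {n} (G : Graph n) (X : Subset n) → IsSimple G →
    ∀ (k : ℕ) → γP[ G ]≡ X k ⇔ γP≡ (ℓ 2 G X) k
proposition3p4 {n} G X _ k = mk⇔ to from
  where
  open LeafGraph G X

  minimal-lifts : (∀ S → X ⊆ S → PowerDominating G S → k ≤ ∣ S ∣) →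
                  ∀ T → PowerDominating H T → k ≤ ∣ T ∣
  minimal-lifts minimal T pd with pd-project T pd
  ... | S , X⊆S , pdS , ∣S∣≤∣T∣ = ≤-trans (minimal S X⊆S pdS) ∣S∣≤∣T∣

  minimal-projects : (∀ T → PowerDominating H T → k ≤ ∣ T ∣) →
                     ∀ S → X ⊆ S → PowerDominating G S → k ≤ ∣ S ∣
  minimal-projects minimal S X⊆S pd = subst (k ≤_) (∣p++⊥∣≡∣p∣ S) (minimal _ (pd-lift X⊆S pd))

  to : γP[ G ]≡ X k → γP≡ H k
  to ((S , X⊆S , pd , ∣S∣≡k) , minimal) =
    (S ++ ⊥ , pd-lift X⊆S pd , trans (∣p++⊥∣≡∣p∣ S) ∣S∣≡k) , minimal-lifts minimal

  from : γP≡ H k → γP[ G ]≡ X k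
  from ((T , pd , ∣T∣≡k) , minimal) with pd-project T pd
  ... | S , X⊆S , pdS , ∣S∣≤∣T∣ =
    (S , X⊆S , pdS , ≤-antisym (subst (∣ S ∣ ≤_) ∣T∣≡k ∣S∣≤∣T∣) (minimal-projects minimal S X⊆S pdS)) ,
    minimal-projects minimal
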